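{- For every closed term $t\in T(\Sigma_{FTP})$ there exists $t'\in T(\Sigma_{FTP})$ in head normal form such that $E_{FTP}\vdash t=t'$.
   Context: Fix a finite nonempty set of actions $\mathcal{A}$, a finite set of predicates $\mathcal{P}$, a subset $\mathcal{P}^I\subseteq\mathcal{P}$ of "implicit" predicates and for each $P\in\mathcal{P}^I$ a set $\mathcal{A}_P\subseteq\mathcal{A}$. The signature $\Sigma_{FTP}$ consists of the constant $\delta$, a constant $\kappa_P$ for each $P\in\mathcal{P}$, a unary prefix $a.\_$ for each $a\in\mathcal{A}$ and binary $+$. Its operational semantics (transitions and predicates on closed terms, the least relations closed under the rules) is given by: $a.x\xrightarrow{a}x$; if $x\xrightarrow{a}x'$ then $x+y\xrightarrow{a}x'$; if $y\xrightarrow{a}y'$ then $x+y\xrightarrow{a}y'$; $P\kappa_P$; if $Px$ then $P(x+y)$; if $Py$ then $P(x+y)$; if $Px$ then $P(a.x)$ for every $P\in\mathcal{P}^I$ and $a\in\mathcal{A}_P$. The axiom system $E_{FTP}$ consists of: $x+y=y+x$; $(x+y)+z=x+(y+z)$; $x+x=x$; $x+\delta=x$; and $a.(x+\kappa_P)=a.(x+\kappa_P)+\kappa_P$ for all $P\in\mathcal{P}^I$, $a\in\mathcal{A}_P$. $E\vdash s=t$ means derivable in equational logic (reflexivity, symmetry, transitivity, substitution instances of axioms, closure under all operations). A term $t$ is in head normal form if $t=\sum_{i\in I}a_i.t_i+\sum_{j\in J}\kappa_{P_j}$ (finite sums, the empty sum being $\delta$) and $\{P_j\mid j\in J\}$ is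 exactly the set of predicates satisfied by $t$. -}

module Defs where

open import Data.Nat using (ℕ)
open import Data.Fin using (Fin)
open import Data.Bool using (Bool; true)
open import Relation.Binary.PropositionalEquality using (_≡_)
open import Data.Product using (_×_)

-- The parameters of the paper's setting:
--   actions     𝒜 = Fin nA      (finite; nonemptiness is a hypothesis of the statement)
--   predicates  𝒫 = Fin nP      (finite)
--   imp P ≡ true     iff  P ∈ 𝒫^I
--   actP P a ≡ true  iff  a ∈ 𝒜_P
module FTP (nA nP : ℕ) (imp : Fin nP → Bool) (actP : Fin nP → Fin nA → Bool) where

  Act  = Fin nA
  Pred = Fin nP

  -- Terms over Σ_FTP with variables (variables are needed for equational logic).
  infixr 6 _⊕_
  data Term : Set where
    var : ℕ → Term
    δ   : Term
    κ   : Pred → Term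
    _∙_ : Act → Term → Term
    _⊕_ : Term → Term → Term

  data Closed : Term → Set where
    δ-c : Closed δ
    κ-c : ∀ P → Closed (κ P)
    ∙-c : ∀ a {x} → Closed x → Closed (a ∙ x)
    ⊕-c : ∀ {x y} → Closed x → Closed y → Closed (x ⊕ y)

  _[_] : Term → (ℕ → Term) → Term
  var n   [ σ ] = σ n
  δ       [ σ ] = δ
  κ P     [ σ ] = κ P
  (a ∙ x) [ σ ] = a ∙ (x [ σ ])
  (x ⊕ y) [ σ ] = (x [ σ ]) ⊕ (y [ σ ])

  -- predicate satisfaction: the least relation closed under the rules
  -- (variables satisfy no predicate; it is only used on closed terms)
  data Sat (P : Pred) : Term → Set where
    κ-sat : Sat P (κ P)
    ⊕ˡ    : ∀ {x y} → Sat P x → Sat P (x ⊕ y)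
    ⊕ʳ    : ∀ {x y} → Sat P y → Sat P (x ⊕ y)
    ∙-sat : ∀ {a x} → imp P ≡ true → actP P a ≡ true → Sat P x → Sat P (a ∙ x)

  private
    x y z : Term
    x = var 0
    y = var 1
    z = var 2

  data Axiom : Term → Term → Set where
    comm  : Axiom (x ⊕ y) (y ⊕ x)
    assoc : Axiom ((x ⊕ y) ⊕ z) (x ⊕ (y ⊕ z))
    idem  : Axiom (x ⊕ x) x
    unit  : Axiom (x ⊕ δ) x
    impl  : ∀ P a → imp P ≡ true → actP P a ≡ true →
            Axiom (a ∙ (x ⊕ κ P)) ((a ∙ (x ⊕ κ P)) ⊕ κ P)

  infix 4 ⊢_≈_
  data ⊢_≈_ : Term → Term → Set where
    ax    : ∀ {s t} (σ : ℕ → Term) → Axiom s t → ⊢ s [ σ ] ≈ t [ σ ]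
    refl  : ∀ {t} → ⊢ t ≈ t
    sym   : ∀ {s t} → ⊢ s ≈ t → ⊢ t ≈ s
    trans : ∀ {s t u} → ⊢ s ≈ t → ⊢ t ≈ u → ⊢ s ≈ u
    ∙-cong : ∀ a {s t} → ⊢ s ≈ t → ⊢ a ∙ s ≈ a ∙ t
    ⊕-cong : ∀ {s s′ t t′} → ⊢ s ≈ s′ → ⊢ t ≈ t′ → ⊢ s ⊕ t ≈ s′ ⊕ t′

  data Summands : Term → Set where
    s-pre : ∀ a u → Summands (a ∙ u)
    s-κ   : ∀ P → Summands (κ P)
    s-⊕   : ∀ {s t} → Summands s → Summands t → Summands (s ⊕ t)

  data IsSum : Term → Set where
    empty    : IsSum δ
    nonempty : ∀ {t} → Summands t → IsSum t

  data κ-summand (P : Pred) : Term → Set where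
    here : κ-summand P (κ P)
    inl  : ∀ {s t} → κ-summand P s → κ-summand P (s ⊕ t)
    inr  : ∀ {s t} → κ-summand P t → κ-summand P (s ⊕ t)

  -- head normal form: sum shape, and {P_j} is exactly the set of predicates t satisfies
  HNF : Term → Set
  HNF t = IsSum t × (∀ P → (Sat P t → κ-summand P t) × (κ-summand P t → Sat P t))

module Submission where

-- The proof has two phases.
--   1. Flattening: since _+_ is commutative, associative and has unit δ, a
--      closed term is provably equal either to δ or to a closed nonempty sum
--      of summands a.u and κ_P (`flatten`).
--   2. Saturation: a sum s satisfies every predicate occurring as a summand
--      κ_P, but may satisfy more (via a summand κ_P nested under a prefix
--      a ∈ 𝒜_P with P implicit).  The key equational fact is absorption,
--      Sat P w → ⊢ w ≈ w + κ_P, proved by induction on the derivation of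
--      Sat P w; its prefix case is exactly the implicit-predicate axiom.
--      Hence adding κ_P for every predicate in a list of predicates that s
--      satisfies (`s ⊕κ L`) preserves provable equality and adds nothing new
--      to the set of satisfied predicates.  Taking L to be the (decidable)
--      list of all predicates satisfied by s yields a head normal form.

open import Defs
open import Data.Nat using (ℕ; _<_)
open import Data.Fin using (Fin)
open import Data.Fin.Properties using (_≟_)
open import Data.Bool using (Bool; true)
open import Data.Bool.Properties using () renaming (_≟_ to _≟ᵇ_)
open import Data.Product using (Σ; _×_; _,_; proj₂)
open import Data.Sum using (_⊎_; inj₁; inj₂; [_,_]; map₂)
open import Data.List using (List; []; _∷_; filter; allFin)
open import Data.List.Membership.Propositional using (_∈_)
open import Data.List.Membership.Propositional.Properties using (∈-filter⁺; ∈-filter⁻; ∈-allFin)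
open import Data.List.Relation.Unary.All using (All; []; _∷_; tabulate; lookup)
open import Data.List.Relation.Unary.Any using (here; there)
open import Relation.Nullary using (yes; no)
open import Relation.Unary using (Decidable)
open import Relation.Binary.Bundles using (Setoid)
import Relation.Binary.PropositionalEquality as ≡
import Relation.Binary.Reasoning.Setoid as SetoidReasoning

module HeadNormalForms (nA nP : ℕ) (imp : Fin nP → Bool) (actP : Fin nP → Fin nA → Bool) where
  open FTP nA nP imp actP

  ⊢-setoid : Setoid _ _
  ⊢-setoid = record
    { Carrier = Term
    ; _≈_ = ⊢_≈_
    ; isEquivalence = record { refl = refl ; sym = sym ; trans = trans }
    }

  open SetoidReasoning ⊢-setoid

  ⟨_,_,_⟩ : Term → Term → Term → ℕ → Term
  ⟨ r , s , t ⟩ 0 = r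
  ⟨ r , s , t ⟩ 1 = s
  ⟨ r , s , t ⟩ _ = t

  ⊕-comm : ∀ r s → ⊢ r ⊕ s ≈ s ⊕ r
  ⊕-comm r s = ax ⟨ r , s , s ⟩ comm

  ⊕-assoc : ∀ r s t → ⊢ (r ⊕ s) ⊕ t ≈ r ⊕ (s ⊕ t)
  ⊕-assoc r s t = ax ⟨ r , s , t ⟩ assoc

  ⊕-idem : ∀ r → ⊢ r ⊕ r ≈ r
  ⊕-idem r = ax ⟨ r , r , r ⟩ idem

  ⊕-identityʳ : ∀ r → ⊢ r ⊕ δ ≈ r
  ⊕-identityʳ r = ax ⟨ r , r , r ⟩ unit

  ⊕-identityˡ : ∀ r → ⊢ δ ⊕ r ≈ r
  ⊕-identityˡ r = trans (⊕-comm δ r) (⊕-identityʳ r)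

  absorb : ∀ {P w} → Sat P w → ⊢ w ≈ w ⊕ κ P
  absorb {P} κ-sat = sym (⊕-idem (κ P))
  absorb {P} (⊕ˡ {r} {s} sat) = begin
    r ⊕ s              ≈⟨ ⊕-cong (absorb sat) refl ⟩
    (r ⊕ κ P) ⊕ s      ≈⟨ ⊕-assoc r (κ P) s ⟩
    r ⊕ (κ P ⊕ s)      ≈⟨ ⊕-cong refl (⊕-comm (κ P) s) ⟩
    r ⊕ (s ⊕ κ P)      ≈⟨ sym (⊕-assoc r s (κ P)) ⟩
    (r ⊕ s) ⊕ κ P      ∎
  absorb {P} (⊕ʳ {r} {s} sat) = begin
    r ⊕ s              ≈⟨ ⊕-cong refl (absorb sat) ⟩
    r ⊕ (s ⊕ κ P)      ≈⟨ sym (⊕-assoc r s (κ P)) ⟩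
    (r ⊕ s) ⊕ κ P      ∎
  absorb {P} (∙-sat {a} {u} isImp inAct sat) = begin
    a ∙ u                      ≈⟨ ∙-cong a (absorb sat) ⟩
    a ∙ (u ⊕ κ P)              ≈⟨ ax ⟨ u , u , u ⟩ (impl P a isImp inAct) ⟩
    a ∙ (u ⊕ κ P) ⊕ κ P        ≈⟨ ⊕-cong (∙-cong a (sym (absorb sat))) refl ⟩
    a ∙ u ⊕ κ P                ∎

  sat? : ∀ t → Decidable (λ P → Sat P t)
  sat? (var n) P = no λ ()
  sat? δ P = no λ ()
  sat? (κ Q) P with P ≟ Q
  ... | yes ≡.refl = yes κ-sat
  ... | no P≢Q = no λ { κ-sat → P≢Q ≡.refl }
  sat? (a ∙ u) P with imp P ≟ᵇ true | actP P a ≟ᵇ true | sat? u P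
  ... | yes isImp | yes inAct | yes sat = yes (∙-sat isImp inAct sat)
  ... | no notImp | _ | _ = no λ { (∙-sat isImp _ _) → notImp isImp }
  ... | yes _ | no notAct | _ = no λ { (∙-sat _ inAct _) → notAct inAct }
  ... | yes _ | yes _ | no unsat = no λ { (∙-sat _ _ sat) → unsat sat }
  sat? (r ⊕ s) P with sat? r P | sat? s P
  ... | yes sat | _ = yes (⊕ˡ sat)
  ... | no _ | yes sat = yes (⊕ʳ sat)
  ... | no unsatʳ | no unsatˢ = no λ { (⊕ˡ sat) → unsatʳ sat ; (⊕ʳ sat) → unsatˢ sat }

  κ-summand⇒Sat : ∀ {P t} → κ-summand P t → Sat P t
  κ-summand⇒Sat here = κ-sat
  κ-summand⇒Sat (inl k) = ⊕ˡ (κ-summand⇒Sat k)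
  κ-summand⇒Sat (inr k) = ⊕ʳ (κ-summand⇒Sat k)

  FlatForm : Term → Set
  FlatForm t = Σ Term (λ s → Closed s × Summands s × ⊢ t ≈ s)

  flatten : ∀ {t} → Closed t → (⊢ t ≈ δ) ⊎ FlatForm t
  flatten δ-c = inj₁ refl
  flatten (κ-c P) = inj₂ (κ P , κ-c P , s-κ P , refl)
  flatten (∙-c a {u} c) = inj₂ (a ∙ u , ∙-c a c , s-pre a u , refl)
  flatten (⊕-c cr cs) with flatten cr | flatten cs
  ... | inj₁ r≈δ | inj₁ s≈δ = inj₁ (trans (⊕-cong r≈δ s≈δ) (⊕-identityʳ δ))
  ... | inj₁ r≈δ | inj₂ (s′ , c , sum , s≈s′) =
    inj₂ (s′ , c , sum , trans (⊕-cong r≈δ s≈s′) (⊕-identityˡ s′))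
  ... | inj₂ (r′ , c , sum , r≈r′) | inj₁ s≈δ =
    inj₂ (r′ , c , sum , trans (⊕-cong r≈r′ s≈δ) (⊕-identityʳ r′))
  ... | inj₂ (r′ , cr′ , sumʳ , r≈r′) | inj₂ (s′ , cs′ , sumˢ , s≈s′) =
    inj₂ (r′ ⊕ s′ , ⊕-c cr′ cs′ , s-⊕ sumʳ sumˢ , ⊕-cong r≈r′ s≈s′)

  infixl 5 _⊕κ_
  _⊕κ_ : Term → List Pred → Term
  s ⊕κ [] = s
  s ⊕κ (P ∷ L) = (s ⊕κ L) ⊕ κ P

  ⊕κ-closed : ∀ {s} L → Closed s → Closed (s ⊕κ L)
  ⊕κ-closed [] c = c
  ⊕κ-closed (P ∷ L) c = ⊕-c (⊕κ-closed L c) (κ-c P)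

  ⊕κ-summands : ∀ {s} L → Summands s → Summands (s ⊕κ L)
  ⊕κ-summands [] sum = sum
  ⊕κ-summands (P ∷ L) sum = s-⊕ (⊕κ-summands L sum) (s-κ P)

  ⊕κ-κ-summand : ∀ {s Q} L → Q ∈ L → κ-summand Q (s ⊕κ L)
  ⊕κ-κ-summand (P ∷ L) (here ≡.refl) = inr here
  ⊕κ-κ-summand (P ∷ L) (there Q∈L) = inl (⊕κ-κ-summand L Q∈L)

  ⊕κ-Sat⁺ : ∀ {s Q} L → Sat Q s → Sat Q (s ⊕κ L)
  ⊕κ-Sat⁺ [] sat = sat
  ⊕κ-Sat⁺ (P ∷ L) sat = ⊕ˡ (⊕κ-Sat⁺ L sat)

  ⊕κ-Sat⁻ : ∀ {s Q} L → Sat Q (s ⊕κ L) → Sat Q s ⊎ Q ∈ L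
  ⊕κ-Sat⁻ [] sat = inj₁ sat
  ⊕κ-Sat⁻ (P ∷ L) (⊕ˡ sat) = map₂ there (⊕κ-Sat⁻ L sat)
  ⊕κ-Sat⁻ (P ∷ L) (⊕ʳ κ-sat) = inj₂ (here ≡.refl)

  ⊕κ-sound : ∀ {s L} → All (λ P → Sat P s) L → ⊢ s ≈ s ⊕κ L
  ⊕κ-sound [] = refl
  ⊕κ-sound {L = P ∷ L} (sat ∷ sats) =
    trans (⊕κ-sound sats) (absorb (⊕κ-Sat⁺ L sat))

  satisfied : Term → List Pred
  satisfied t = filter (sat? t) (allFin nP)

  satisfied-sound : ∀ t → All (λ P → Sat P t) (satisfied t)
  satisfied-sound t = tabulate (λ P∈ → proj₂ (∈-filter⁻ (sat? t) {xs = allFin nP} P∈))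

  satisfied-complete : ∀ {t P} → Sat P t → P ∈ satisfied t
  satisfied-complete {t} {P} = ∈-filter⁺ (sat? t) (∈-allFin P)

  saturate-HNF : ∀ {s} → Summands s → HNF (s ⊕κ satisfied s)
  saturate-HNF {s} sum = nonempty (⊕κ-summands L sum) , λ P →
      (λ sat → ⊕κ-κ-summand L (satisfied-complete (satisfied-back sat)))
    , κ-summand⇒Sat
    where
      L : List Pred
      L = satisfied s

      satisfied-back : ∀ {P} → Sat P (s ⊕κ L) → Sat P s
      satisfied-back sat = [ (λ satˢ → satˢ) , lookup (satisfied-sound s) ] (⊕κ-Sat⁻ L sat)

  δ-HNF : HNF δ
  δ-HNF = empty , λ P → (λ ()) , (λ ())

  head-normal-form : (t : Term) → Closed t → Σ Term (λ t′ → Closed t′ × HNF t′ × ⊢ t ≈ t′)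
  head-normal-form t c with flatten c
  ... | inj₁ t≈δ = δ , δ-c , δ-HNF , t≈δ
  ... | inj₂ (s , cs , sum , t≈s) =
    s ⊕κ satisfied s , ⊕κ-closed (satisfied s) cs , saturate-HNF sum ,
    trans t≈s (⊕κ-sound (satisfied-sound s))

lemma8 : (nA nP : ℕ) (imp : Fin nP → Bool) (actP : Fin nP → Fin nA → Bool) → 0 < nA →
    let open FTP nA nP imp actP in
      (t : Term) → Closed t → Σ Term (λ t′ → Closed t′ × HNF t′ × ⊢ t ≈ t′)
lemma8 nA nP imp actP _ = HeadNormalForms.head-normal-form nA nP imp actP
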